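{- Let $p$ be a prime and $q=p^s$. For $a\in\mathbb{Z}_+$ let $m=m(a)$ be the smallest nonnegative integer with $a\le p^m$, $r_a=(q-1)p^m$, $\phi_a(l)=r_a-a-l(q-1)$; for $0\le j\le p^m-a$ let $i_j$ be the unique integer with $0\le i_j<q-1$ and $j+i_jp^m\equiv0\pmod{q-1}$, $l_j=(j+i_jp^m)/(q-1)$, $f_{a,j}=(-1)^j\binom{p^m-a}{j}\in\mathbb{F}_p$, and $$T_a=\{(f_{a,j},\phi_a(l_j))\mid 0\le j\le p^m-a,\ f_{a,j}\neq0\}.$$ Then: (a) $(1,\phi_a(0))=(1,r_a-a)\in T_a$; (b) $T_a=\{(1,\phi_a(0))\}$ if and only if $a=p^m$; (c) if $m'\in\mathbb{Z}_+$ and $a'=p^{m'}a$, then $T_{a'}=\{(f_{a,j},p^{m'}\phi_a(l_j))\mid 0\le j\le p^{m}-a,\ f_{a,j}\neq0\}$ (with $m=m(a)$); (d) if $q$ is prime, then $T_a=\{(c_{a,l_j},\phi_a(l_j))\mid 0\le j\le p^m-a,\ f_{a,j}\neq0\}$.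
   Context: Let $j_{a,\max}=\lfloor (r_a-a)/(q-1)\rfloor$. For $q$ prime and $0\le j\le j_{a,\max}$ define $c_{a,j}\in\mathbb{F}_p$ by $c_{a,0}=1$ and, for $0<j\le j_{a,\max}$, $c_{a,j}=\lceil j(q-1)/j_{a,\max}\rceil^{ -1}\binom{r_a-a}{j(q-1)}$ (inverse in $\mathbb{F}_p$). -}

module Defs where

open import Data.Nat using (ℕ; zero; suc; _+_; _*_; _∸_; _^_; _≤_; _≤ᵇ_; _≡ᵇ_; _/_; _%_)
open import Data.Nat.Divisibility using (_∣?_)
open import Data.Nat.Combinatorics using (_C_)
open import Data.Bool using (Bool; if_then_else_)
open import Data.Product using (_×_; _,_; ∃-syntax)
open import Relation.Nullary.Decidable using (⌊_⌋)
open import Relation.Binary.PropositionalEquality using (_≡_; _≢_)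

-- Bounded search: the least i < n with P i (returns n if there is none).
least : ℕ → (ℕ → Bool) → ℕ
least zero    P = zero
least (suc n) P = if P 0 then 0 else suc (least n (λ i → P (suc i)))

-- Total division / remainder (junk value when the divisor is 0; never used there).
divN : ℕ → ℕ → ℕ
divN x zero    = 0
divN x (suc d) = x / suc d

modN : ℕ → ℕ → ℕ
modN x zero    = x
modN x (suc d) = x % suc d

ceilDiv : ℕ → ℕ → ℕ
ceilDiv n zero    = 0
ceilDiv n (suc d) = (n + d) / suc d

-- Elements of F_p are represented by their canonical representatives in {0,…,p-1}.
-- (-1)^j · x in F_p
signF : ℕ → ℕ → ℕ → ℕ
signF p j x = if modN j 2 ≡ᵇ 0 then modN x p else modN (p ∸ modN x p) p

invF : ℕ → ℕ → ℕ
invF p x = least p (λ y → modN (x * y) p ≡ᵇ 1)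

-- m(a): smallest m ≥ 0 with a ≤ p^m  (some m ≤ a works since p ≥ 2)
mOf : ℕ → ℕ → ℕ
mOf p a = least (suc a) (λ k → a ≤ᵇ p ^ k)

rOf : ℕ → ℕ → ℕ → ℕ
rOf p q a = (q ∸ 1) * p ^ mOf p a

-- φ_a(l) = r_a - a - l(q-1)   (nonnegative for all l = l_j used below)
φ : ℕ → ℕ → ℕ → ℕ → ℕ
φ p q a l = rOf p q a ∸ a ∸ l * (q ∸ 1)

iOf : ℕ → ℕ → ℕ → ℕ → ℕ
iOf p q a j = least (q ∸ 1) (λ i → ⌊ (q ∸ 1) ∣? (j + i * p ^ mOf p a) ⌋)

lOf : ℕ → ℕ → ℕ → ℕ → ℕ
lOf p q a j = divN (j + iOf p q a j * p ^ mOf p a) (q ∸ 1)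

fOf : ℕ → ℕ → ℕ → ℕ
fOf p a j = signF p j ((p ^ mOf p a ∸ a) C j)

jmax : ℕ → ℕ → ℕ → ℕ
jmax p q a = divN (rOf p q a ∸ a) (q ∸ 1)

cOf : ℕ → ℕ → ℕ → ℕ → ℕ
cOf p q a zero = modN 1 p
cOf p q a j@(suc _) =
  modN (invF p (ceilDiv (j * (q ∸ 1)) (jmax p q a)) * ((rOf p q a ∸ a) C (j * (q ∸ 1)))) p

Pair : Set
Pair = ℕ × ℕ

SetEq : (Pair → Set) → (Pair → Set) → Set
SetEq A B = ∀ x → (A x → B x) × (B x → A x)

T : ℕ → ℕ → ℕ → Pair → Set
T p q a x = ∃[ j ] (j ≤ p ^ mOf p a ∸ a × fOf p a j ≢ 0 × x ≡ (fOf p a j , φ p q a (lOf p q a j)))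

Tscaled : ℕ → ℕ → ℕ → ℕ → Pair → Set
Tscaled p q a m' x = ∃[ j ] (j ≤ p ^ mOf p a ∸ a × fOf p a j ≢ 0 ×
  x ≡ (fOf p a j , p ^ m' * φ p q a (lOf p q a j)))

Tc : ℕ → ℕ → ℕ → Pair → Set
Tc p q a x = ∃[ j ] (j ≤ p ^ mOf p a ∸ a × fOf p a j ≢ 0 ×
  x ≡ (cOf p q a (lOf p q a j) , φ p q a (lOf p q a j)))

module Submission where

-- Write p = 2 + k and q = p^s = 2 + D; then q - 1 = 1 + D is prime to p,
-- and elements of F_p are residues, the sign (-1)^i being (p - 1)^i.
-- The arithmetic core is Lucas' theorem modulo p, for binomial coefficients
-- given by Pascal's triangle, with C(p-1,i) ≡ (-1)^i and C(p-2,i) ≡ (-1)^i (i+1).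
-- Since p^m is a unit modulo q - 1, each i_j truly solves j + i p^m ≡ 0,
-- so that l_j (q - 1) = j + i_j p^m.  Then
--  (a) j = 0 contributes (1, φ_a(0));
--  (b) if a < p^m, then j = p^m - a gives f = ±1 and φ_a(l_j) < φ_a(0);
--  (c) m(p^e a) = e + m(a); by Lucas, f_{p^e a,j} vanishes unless p^e ∣ j,
--      and j = t p^e reproduces f_{a,t} with l and φ scaled by p^e;
--  (d) for q = p, ⌈l_j (p-1)/j_{a,max}⌉ = i_j + 1 and, by Lucas,
--      C(r_a - a, l_j (p-1)) ≡ C(p-2,i_j) C(p^m-a,j), so c_{a,l_j} = f_{a,j}.

open import Defs
open import Data.Nat using (ℕ; _*_; _^_; _≤_)
open import Data.Nat.Primality using (Prime)
open import Data.Product using (_×_; _,_)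
open import Relation.Binary.PropositionalEquality using (_≡_)

open import Data.Nat
open import Data.Nat.Properties
open import Data.Nat.DivMod
open import Data.Nat.Divisibility
open import Data.Nat.Primality
open import Data.Nat.Coprimality using (Coprime; coprime-Bézout; coprime-divisor; prime⇒coprime)
open import Data.Nat.GCD using (module Bézout)
open import Data.Nat.Combinatorics using (_C_; nCk+nC[k+1]≡[n+1]C[k+1]; nCn≡1)
open import Data.Nat.Tactic.RingSolver using (solve-∀)
open import Data.Bool using (Bool; true; false; if_then_else_)
open import Data.Bool.Properties using (T-≡)
open import Data.Product using (∃-syntax; proj₁; proj₂)
open import Data.Sum using (_⊎_; inj₁; inj₂)
open import Data.Empty using (⊥-elim)
open import Function.Base using (case_of_)
open import Function.Bundles using (_⇔_; mk⇔; Equivalence)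
open import Relation.Nullary using (Dec; yes; no; ¬_)
open import Relation.Nullary.Decidable using (⌊_⌋; isYes≗does; dec-true; does-⇔; toWitness)
open import Relation.Binary.Bundles using (Setoid)
open import Relation.Binary.Structures using (IsEquivalence)
open import Relation.Binary.PropositionalEquality
  using (_≢_; refl; sym; trans; cong; cong₂; subst; subst₂; module ≡-Reasoning)
import Relation.Binary.Reasoning.Setoid as SetoidReasoning

least-sound : ∀ n P → least n P < n → P (least n P) ≡ true
least-sound zero    P ()
least-sound (suc n) P lt with P 0 in P0
... | true  = P0
... | false = least-sound n (λ i → P (suc i)) (s≤s⁻¹ lt)

least-before : ∀ n P i → i < least n P → P i ≡ false
least-before zero    P i       ()
least-before (suc n) P i       lt with P 0 in P0
least-before (suc n) P i       () | true
least-before (suc n) P zero    lt | false = P0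
least-before (suc n) P (suc i) lt | false = least-before n (λ i → P (suc i)) i (s≤s⁻¹ lt)

least-minimal : ∀ n P k → P k ≡ true → least n P ≤ k
least-minimal n P k Pk with least n P ≤? k
... | yes le = le
... | no  gt with trans (sym Pk) (least-before n P k (≰⇒> gt))
... | ()

least-found : ∀ n P k → k < n → P k ≡ true → least n P < n × P (least n P) ≡ true
least-found n P k k<n Pk = found , least-sound n P found
  where
  found : least n P < n
  found = ≤-<-trans (least-minimal n P k Pk) k<n

least-unique : ∀ n P k → k < n → P k ≡ true → (∀ i → i < k → P i ≡ false) → least n P ≡ k
least-unique n P k k<n Pk before with m≤n⇒m<n∨m≡n (least-minimal n P k Pk)
... | inj₂ eq = eq
... | inj₁ lt with trans (sym (least-sound n P (<-trans lt k<n))) (before _ lt)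
... | ()

least-cong : ∀ n P Q → (∀ i → P i ≡ Q i) → least n P ≡ least n Q
least-cong zero    P Q P≗Q = refl
least-cong (suc n) P Q P≗Q rewrite P≗Q 0 with Q 0
... | true  = refl
... | false = cong suc (least-cong n _ _ (λ i → P≗Q (suc i)))

⌊⌋-true : ∀ {A : Set} (a? : Dec A) → A → ⌊ a? ⌋ ≡ true
⌊⌋-true a? a = trans (isYes≗does a?) (dec-true a? a)

⌊⌋-sound : ∀ {A : Set} (a? : Dec A) → ⌊ a? ⌋ ≡ true → A
⌊⌋-sound a? eq = toWitness (Equivalence.from T-≡ eq)

⌊⌋-⇔ : ∀ {A B : Set} → A ⇔ B → (a? : Dec A) (b? : Dec B) → ⌊ a? ⌋ ≡ ⌊ b? ⌋
⌊⌋-⇔ A⇔B a? b? = trans (isYes≗does a?) (trans (does-⇔ A⇔B a? b?) (sym (isYes≗does b?)))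

≤⇒≤ᵇ≡true : ∀ {m n} → m ≤ n → (m ≤ᵇ n) ≡ true
≤⇒≤ᵇ≡true le = Equivalence.to T-≡ (≤⇒≤ᵇ le)

≤ᵇ≡true⇒≤ : ∀ {m n} → (m ≤ᵇ n) ≡ true → m ≤ n
≤ᵇ≡true⇒≤ {m} {n} eq = ≤ᵇ⇒≤ m n (Equivalence.from T-≡ eq)

≰⇒≤ᵇ≡false : ∀ {m n} → ¬ (m ≤ n) → (m ≤ᵇ n) ≡ false
≰⇒≤ᵇ≡false {m} {n} m≰n with m ≤ᵇ n in eq
... | true  = ⊥-elim (m≰n (≤ᵇ≡true⇒≤ eq))
... | false = refl

module Congruence (n : ℕ) .{{_ : NonZero n}} where

  -- x ≈ y means x ≡ y (mod n); a record so that x and y stay inferable.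
  infix 4 _≈_
  record _≈_ (x y : ℕ) : Set where
    constructor mk≈
    field residue-eq : x % n ≡ y % n
  open _≈_ public

  ≈-isEquivalence : IsEquivalence _≈_
  ≈-isEquivalence = record
    { refl  = mk≈ refl
    ; sym   = λ (mk≈ e) → mk≈ (sym e)
    ; trans = λ (mk≈ e) (mk≈ f) → mk≈ (trans e f)
    }

  ≈-setoid : Setoid _ _
  ≈-setoid = record { isEquivalence = ≈-isEquivalence }

  open IsEquivalence ≈-isEquivalence public
    using () renaming (refl to ≈-refl; sym to ≈-sym; trans to ≈-trans)
  module ≈-Reasoning = SetoidReasoning ≈-setoid

  ≡⇒≈ : ∀ {x y} → x ≡ y → x ≈ y
  ≡⇒≈ refl = ≈-refl

  +-cong : ∀ {x y u v} → x ≈ y → u ≈ v → x + u ≈ y + v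
  +-cong {x} {y} {u} {v} (mk≈ e) (mk≈ f) = mk≈ (begin
    (x + u) % n           ≡⟨ %-distribˡ-+ x u n ⟩
    (x % n + u % n) % n   ≡⟨ cong₂ (λ s t → (s + t) % n) e f ⟩
    (y % n + v % n) % n   ≡⟨ %-distribˡ-+ y v n ⟨
    (y + v) % n           ∎)
    where open ≡-Reasoning

  *-cong : ∀ {x y u v} → x ≈ y → u ≈ v → x * u ≈ y * v
  *-cong {x} {y} {u} {v} (mk≈ e) (mk≈ f) = mk≈ (begin
    (x * u) % n             ≡⟨ %-distribˡ-* x u n ⟩
    (x % n * (u % n)) % n   ≡⟨ cong₂ (λ s t → (s * t) % n) e f ⟩
    (y % n * (v % n)) % n   ≡⟨ %-distribˡ-* y v n ⟨
    (y * v) % n             ∎)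
    where open ≡-Reasoning

  ^-cong : ∀ {x y} e → x ≈ y → x ^ e ≈ y ^ e
  ^-cong zero    x≈y = ≈-refl
  ^-cong (suc e) x≈y = *-cong x≈y (^-cong e x≈y)

  %-≈ : ∀ x → x % n ≈ x
  %-≈ x = mk≈ (m%n%n≡m%n x n)

  ∣⇒≈0 : ∀ {x} → n ∣ x → x ≈ 0
  ∣⇒≈0 {x} n∣x = mk≈ (trans (n∣m⇒m%n≡0 x n n∣x) (sym (m<n⇒m%n≡m (>-nonZero⁻¹ n))))

  ≈0⇒∣ : ∀ {x} → x ≈ 0 → n ∣ x
  ≈0⇒∣ {x} (mk≈ e) = m%n≡0⇒n∣m x n (trans e (m<n⇒m%n≡m (>-nonZero⁻¹ n)))

  multiple≈0 : ∀ k → k * n ≈ 0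
  multiple≈0 k = ∣⇒≈0 (n∣m*n k)

  x+[n∸x%n]≈0 : ∀ x → x + (n ∸ x % n) ≈ 0
  x+[n∸x%n]≈0 x = ∣⇒≈0 (divides (suc (x / n)) (begin
    x + (n ∸ x % n)                   ≡⟨ cong (_+ (n ∸ x % n)) (m≡m%n+[m/n]*n x n) ⟩
    x % n + x / n * n + (n ∸ x % n)   ≡⟨ rearrange (x % n) (x / n * n) (n ∸ x % n) ⟩
    x / n * n + (x % n + (n ∸ x % n)) ≡⟨ cong (x / n * n +_) (m+[n∸m]≡n (m%n≤n x n)) ⟩
    x / n * n + n                     ≡⟨ +-comm (x / n * n) n ⟩
    suc (x / n) * n                   ∎))
    where
    open ≡-Reasoning
    rearrange : ∀ a b c → a + b + c ≡ b + (a + c)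
    rearrange = solve-∀

  x+pred[n]*x≈0 : ∀ x → x + pred n * x ≈ 0
  x+pred[n]*x≈0 x = ∣⇒≈0 (divides x (trans (cong (_* x) (suc-pred n)) (*-comm n x)))

  +-cancelʳ : ∀ {x y} c → x + c ≈ y + c → x ≈ y
  +-cancelʳ {x} {y} c x+c≈y+c = begin
    x                 ≡⟨ +-identityʳ x ⟨
    x + 0             ≈⟨ +-cong (≈-refl {x}) (x+[n∸x%n]≈0 c) ⟨
    x + (c + c⁻)      ≡⟨ +-assoc x c c⁻ ⟨
    x + c + c⁻        ≈⟨ +-cong x+c≈y+c (≈-refl {c⁻}) ⟩
    y + c + c⁻        ≡⟨ +-assoc y c c⁻ ⟩
    y + (c + c⁻)      ≈⟨ +-cong (≈-refl {y}) (x+[n∸x%n]≈0 c) ⟩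
    y + 0             ≡⟨ +-identityʳ y ⟩
    y                 ∎
    where
    open ≈-Reasoning
    c⁻ : ℕ
    c⁻ = n ∸ c % n

  +-cancelˡ : ∀ c {x y} → c + x ≈ c + y → x ≈ y
  +-cancelˡ c {x} {y} c+x≈c+y =
    +-cancelʳ c (≈-trans (≡⇒≈ (+-comm x c)) (≈-trans c+x≈c+y (≡⇒≈ (+-comm c y))))

  coprime⇒invertible : ∀ {x} → Coprime n x → ∃[ y ] x * y ≈ 1
  coprime⇒invertible {x} n⊥x with coprime-Bézout n⊥x
  ... | Bézout.-+ a b eq = b , ≈-trans (≡⇒≈ (trans (*-comm x b) (sym eq))) 1+an≈1
    where
    1+an≈1 : 1 + a * n ≈ 1
    1+an≈1 = ≈-trans (+-cong (≈-refl {1}) (multiple≈0 a)) ≈-refl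
  ... | Bézout.+- a b eq = b * pred n , +-cancelʳ (pred n) xy+pred≈1+pred
    where
    open ≈-Reasoning
    regroup : ∀ x b m → x * (b * m) + m ≡ m * (1 + b * x)
    regroup = solve-∀
    xy+pred≈1+pred : x * (b * pred n) + pred n ≈ 1 + pred n
    xy+pred≈1+pred = begin
      x * (b * pred n) + pred n  ≡⟨ regroup x b (pred n) ⟩
      pred n * (1 + b * x)       ≡⟨ cong (pred n *_) eq ⟩
      pred n * (a * n)           ≡⟨ *-assoc (pred n) a n ⟨
      pred n * a * n             ≈⟨ multiple≈0 (pred n * a) ⟩
      0                          ≈⟨ multiple≈0 1 ⟨
      1 * n                      ≡⟨ *-comm 1 n ⟩
      n * 1                      ≡⟨ cong (_* 1) (suc-pred n) ⟨
      suc (pred n) * 1           ≡⟨ cong suc (*-identityʳ (pred n)) ⟩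
      1 + pred n                 ∎


  unit⇒solvable : ∀ {x} → Coprime n x → ∀ j → ∃[ i ] i < n × n ∣ j + i * x
  unit⇒solvable {x} n⊥x j with coprime⇒invertible n⊥x
  ... | y , xy≈1 = i , m%n<n (pred n * j * y) n , ≈0⇒∣ (begin
    j + i * x                    ≈⟨ +-cong (≈-refl {j}) (*-cong (%-≈ (pred n * j * y)) (≈-refl {x})) ⟩
    j + pred n * j * y * x       ≡⟨ cong (j +_) (*-assoc (pred n * j) y x) ⟩
    j + pred n * j * (y * x)
      ≈⟨ +-cong (≈-refl {j}) (*-cong (≈-refl {pred n * j}) (≈-trans (≡⇒≈ (*-comm y x)) xy≈1)) ⟩
    j + pred n * j * 1           ≡⟨ cong (j +_) (*-identityʳ (pred n * j)) ⟩
    j + pred n * j               ≈⟨ x+pred[n]*x≈0 j ⟩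
    0                            ∎)
    where
    open ≈-Reasoning
    i : ℕ
    i = (pred n * j * y) % n

coprime-* : ∀ {n x y} → Coprime n x → Coprime n y → Coprime n (x * y)
coprime-* {n} {x} n⊥x n⊥y {i} (i∣n , i∣xy) = n⊥y (i∣n , coprime-divisor i⊥x i∣xy)
  where
  i⊥x : Coprime i x
  i⊥x (j∣i , j∣x) = n⊥x (∣-trans j∣i i∣n , j∣x)

coprime-^ : ∀ {n x} → Coprime n x → ∀ e → Coprime n (x ^ e)
coprime-^ n⊥x zero    (_ , i∣1) = ∣1⇒≡1 i∣1
coprime-^ n⊥x (suc e) = coprime-* n⊥x (coprime-^ n⊥x e)

-- Binomial coefficients as Pascal's triangle.  This recursive form is
-- convenient for induction; it agrees with the library's `_C_`.

binom : ℕ → ℕ → ℕ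
binom n       zero    = 1
binom zero    (suc k) = 0
binom (suc n) (suc k) = binom n k + binom n (suc k)

binom≡C : ∀ n k → binom n k ≡ n C k
binom≡C n       zero    = refl
binom≡C zero    (suc k) = refl
binom≡C (suc n) (suc k) =
  trans (cong₂ _+_ (binom≡C n k) (binom≡C n (suc k))) (nCk+nC[k+1]≡[n+1]C[k+1] n k)

binom-vanish : ∀ n k → n < k → binom n k ≡ 0
binom-vanish zero    (suc k) _         = refl
binom-vanish (suc n) (suc k) (s≤s n<k) =
  cong₂ _+_ (binom-vanish n k n<k) (binom-vanish n (suc k) (m<n⇒m<1+n n<k))

binom-diagonal : ∀ n → binom n n ≡ 1
binom-diagonal zero    = refl
binom-diagonal (suc n) = cong₂ _+_ (binom-diagonal n) (binom-vanish n (suc n) ≤-refl)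

-- Absorption identity (k+1)·C(n+1,k+1) = (n+1)·C(n,k); it yields p ∣ C(p,k).
binom-absorb : ∀ n k → suc k * binom (suc n) (suc k) ≡ suc n * binom n k
binom-absorb zero    zero    = refl
binom-absorb zero    (suc k) = *-zeroʳ (suc (suc k))
binom-absorb (suc n) zero    = begin
  1 * (1 + binom (suc n) 1)  ≡⟨ *-identityˡ _ ⟩
  1 + binom (suc n) 1        ≡⟨ cong suc (trans (sym (*-identityˡ _)) (binom-absorb n 0)) ⟩
  suc (suc n) * 1            ∎
  where open ≡-Reasoning
binom-absorb (suc n) (suc k) = begin
  suc (suc k) * (x + y)              ≡⟨ expand (suc k) x y ⟩
  x + suc k * x + suc (suc k) * y    ≡⟨ cong₂ (λ u v → x + u + v) (binom-absorb n k) (binom-absorb n (suc k)) ⟩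
  x + suc n * binom n k + suc n * binom n (suc k) ≡⟨ collect (suc n) x (binom n k) (binom n (suc k)) ⟩
  suc (suc n) * x                    ∎
  where
  open ≡-Reasoning
  x y : ℕ
  x = binom (suc n) (suc k)
  y = binom (suc n) (suc (suc k))
  expand : ∀ m x y → suc m * (x + y) ≡ x + m * x + suc m * y
  expand = solve-∀
  collect : ∀ m x z w → x + m * z + m * w ≡ x + m * (z + w)
  collect = solve-∀

signF-parity : ∀ n j j' x → j % 2 ≡ j' % 2 → signF n j x ≡ signF n j' x
signF-parity n j j' x e = cong (λ r → if r ≡ᵇ 0 then modN x n else modN (n ∸ modN x n) n) e

signF-two : ∀ j x → signF 2 j x ≡ x % 2
signF-two j x with j % 2 ≡ᵇ 0
... | true  = refl
... | false with x % 2 | m%n<n x 2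
...   | 0           | _               = refl
...   | 1           | _               = refl
...   | suc (suc _) | s≤s (s≤s ())

prime-two-or-odd : ∀ k → Prime (2 + k) → k ≡ 0 ⊎ (2 + k) % 2 ≡ 1
prime-two-or-odd zero    _       = inj₁ refl
prime-two-or-odd (suc k) p-prime with (3 + k) % 2 in e | m%n<n (3 + k) 2
... | 0           | _ = ⊥-elim (prime⇒¬composite p-prime (composite (s≤s (s≤s z<s)) (m%n≡0⇒n∣m (3 + k) 2 e)))
... | 1           | _ = inj₂ refl
... | suc (suc _) | s≤s (s≤s ())

module ModPrime (k : ℕ) (p-prime : Prime (2 + k)) where

  p : ℕ
  p = 2 + k

  open Congruence p public

  -- p ∣ C(p,j) for 0 < j < p: absorption plus Euclid's lemma.
  p∣binom[p,j] : ∀ j → 0 < j → j < p → p ∣ binom p j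
  p∣binom[p,j] (suc j) _ j<p
    with euclidsLemma (suc j) (binom p (suc j)) p-prime
           (divides (binom (suc k) j) (trans (binom-absorb (suc k) j) (*-comm p (binom (suc k) j))))
  ... | inj₂ p∣C   = p∣C
  ... | inj₁ p∣1+j = ⊥-elim (<⇒≱ j<p (∣⇒≤ p∣1+j))

  binom-shift-low : ∀ n j → j < p → binom (n + p) j ≈ binom n j
  binom-shift-low zero    zero    _   = ≈-refl
  binom-shift-low zero    (suc j) j<p = ∣⇒≈0 (p∣binom[p,j] (suc j) z<s j<p)
  binom-shift-low (suc n) zero    _   = ≈-refl
  binom-shift-low (suc n) (suc j) j<p =
    +-cong (binom-shift-low n j (<-trans (n<1+n j) j<p)) (binom-shift-low n (suc j) j<p)

  pascal-shifted : ∀ n j → binom (suc n) (j + p) ≡ binom n (j + suc k) + binom n (j + p)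
  pascal-shifted n j rewrite +-suc j (suc k) = refl

  binom-shift-high : ∀ n j → binom (n + p) (j + p) ≈ binom n (j + p) + binom n j
  binom-shift-high zero    zero    = ≡⇒≈ (binom-diagonal p)
  binom-shift-high zero    (suc j) = ≡⇒≈ (binom-vanish p (suc j + p) (s≤s (m≤n+m p j)))
  binom-shift-high (suc n) zero    = begin
    binom (suc n + p) p                         ≡⟨ pascal-shifted (n + p) 0 ⟩
    binom (n + p) (suc k) + binom (n + p) p     ≈⟨ +-cong (binom-shift-low n (suc k) ≤-refl) (binom-shift-high n 0) ⟩
    binom n (suc k) + (binom n p + 1)           ≡⟨ +-assoc (binom n (suc k)) (binom n p) 1 ⟨
    binom n (suc k) + binom n p + 1             ≡⟨ cong (_+ 1) (pascal-shifted n 0) ⟨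
    binom (suc n) p + binom (suc n) 0           ∎
    where open ≈-Reasoning
  binom-shift-high (suc n) (suc j) = begin
    binom (suc n + p) (suc j + p)
      ≡⟨ trans (pascal-shifted (n + p) (suc j)) (cong (λ t → binom (n + p) t + binom (n + p) (suc j + p)) j+p) ⟩
    binom (n + p) (j + p) + binom (n + p) (suc j + p)
      ≈⟨ +-cong (binom-shift-high n j) (binom-shift-high n (suc j)) ⟩
    (binom n (j + p) + binom n j) + (binom n (suc j + p) + binom n (suc j))
      ≡⟨ interchange (binom n (j + p)) (binom n j) (binom n (suc j + p)) (binom n (suc j)) ⟩
    (binom n (j + p) + binom n (suc j + p)) + binom (suc n) (suc j)
      ≡⟨ cong (λ t → (binom n t + binom n (suc j + p)) + binom (suc n) (suc j)) j+p ⟨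
    (binom n (suc j + suc k) + binom n (suc j + p)) + binom (suc n) (suc j)
      ≡⟨ cong (_+ binom (suc n) (suc j)) (pascal-shifted n (suc j)) ⟨
    binom (suc n) (suc j + p) + binom (suc n) (suc j) ∎
    where
    open ≈-Reasoning
    j+p : suc j + suc k ≡ j + p
    j+p = sym (+-suc j (suc k))
    interchange : ∀ a b c d → (a + b) + (c + d) ≡ (a + c) + (b + d)
    interchange = solve-∀

  add-digit : ∀ a b → suc a * p + b ≡ a * p + b + p
  add-digit a b = shape a b k
    where
    shape : ∀ a b k → suc a * (2 + k) + b ≡ a * (2 + k) + b + (2 + k)
    shape = solve-∀

  lucas-digit : ∀ a b c e → b < p → e < p →
                binom (a * p + b) (c * p + e) ≈ binom a c * binom b e
  lucas-digit zero    b zero    e _   _   = ≡⇒≈ (sym (+-identityʳ (binom b e)))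
  lucas-digit zero    b (suc c) e b<p _   =
    ≡⇒≈ (binom-vanish b (suc c * p + e) (<-≤-trans b<p (≤-trans (m≤m+n p (c * p)) (m≤m+n _ e))))
  lucas-digit (suc a) b zero    e b<p e<p = begin
    binom (suc a * p + b) e   ≡⟨ cong (λ t → binom t e) (add-digit a b) ⟩
    binom (a * p + b + p) e   ≈⟨ binom-shift-low (a * p + b) e e<p ⟩
    binom (a * p + b) e       ≈⟨ lucas-digit a b 0 e b<p e<p ⟩
    binom (suc a) 0 * binom b e ∎
    where open ≈-Reasoning
  lucas-digit (suc a) b (suc c) e b<p e<p = begin
    binom (suc a * p + b) (suc c * p + e)
      ≡⟨ cong₂ binom (add-digit a b) (add-digit c e) ⟩
    binom (a * p + b + p) (c * p + e + p)
      ≈⟨ binom-shift-high (a * p + b) (c * p + e) ⟩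
    binom (a * p + b) (c * p + e + p) + binom (a * p + b) (c * p + e)
      ≡⟨ cong (λ t → binom (a * p + b) t + binom (a * p + b) (c * p + e)) (add-digit c e) ⟨
    binom (a * p + b) (suc c * p + e) + binom (a * p + b) (c * p + e)
      ≈⟨ +-cong (lucas-digit a b (suc c) e b<p e<p) (lucas-digit a b c e b<p e<p) ⟩
    binom a (suc c) * binom b e + binom a c * binom b e
      ≡⟨ *-distribʳ-+ (binom b e) (binom a (suc c)) (binom a c) ⟨
    (binom a (suc c) + binom a c) * binom b e
      ≡⟨ cong (_* binom b e) (+-comm (binom a (suc c)) (binom a c)) ⟩
    binom (suc a) (suc c) * binom b e ∎
    where open ≈-Reasoning

  lucas : ∀ m A N i j → N < p ^ m → j < p ^ m →
          binom (A * p ^ m + N) (i * p ^ m + j) ≈ binom A i * binom N j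
  lucas zero A zero    i zero    _        _ = ≡⇒≈ (begin
    binom (A * 1 + 0) (i * 1 + 0) ≡⟨ cong₂ binom (one-digit A) (one-digit i) ⟩
    binom A i                     ≡⟨ *-identityʳ (binom A i) ⟨
    binom A i * 1                 ∎)
    where
    open ≡-Reasoning
    one-digit : ∀ x → x * 1 + 0 ≡ x
    one-digit x = trans (+-identityʳ (x * 1)) (*-identityʳ x)
  lucas zero A (suc N) i j       (s≤s ()) _
  lucas zero A zero    i (suc j) _        (s≤s ())
  lucas (suc m) A N i j N<pM j<pM = begin
    binom (A * (p * M) + N) (i * (p * M) + j)
      ≡⟨ cong₂ binom (split A N) (split i j) ⟩
    binom ((A * M + N / p) * p + N % p) ((i * M + j / p) * p + j % p)
      ≈⟨ lucas-digit (A * M + N / p) (N % p) (i * M + j / p) (j % p) (m%n<n N p) (m%n<n j p) ⟩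
    binom (A * M + N / p) (i * M + j / p) * binom (N % p) (j % p)
      ≈⟨ *-cong (lucas m A (N / p) i (j / p) (high N N<pM) (high j j<pM)) (≈-refl {binom (N % p) (j % p)}) ⟩
    binom A i * binom (N / p) (j / p) * binom (N % p) (j % p)
      ≡⟨ *-assoc (binom A i) (binom (N / p) (j / p)) (binom (N % p) (j % p)) ⟩
    binom A i * (binom (N / p) (j / p) * binom (N % p) (j % p))
      ≈⟨ *-cong (≈-refl {binom A i}) (lucas-digit (N / p) (N % p) (j / p) (j % p) (m%n<n N p) (m%n<n j p)) ⟨
    binom A i * binom (N / p * p + N % p) (j / p * p + j % p)
      ≡⟨ cong₂ (λ u v → binom A i * binom u v) (digits N) (digits j) ⟨
    binom A i * binom N j ∎
    where
    open ≈-Reasoning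
    M : ℕ
    M = p ^ m
    digits : ∀ x → x ≡ x / p * p + x % p
    digits x = trans (m≡m%n+[m/n]*n x p) (+-comm (x % p) (x / p * p))
    split : ∀ x y → x * (p * M) + y ≡ (x * M + y / p) * p + y % p
    split x y = trans (cong (x * (p * M) +_) (digits y)) (regroup x (y / p) (y % p) p M)
      where
      regroup : ∀ x u v p M → x * (p * M) + (u * p + v) ≡ (x * M + u) * p + v
      regroup = solve-∀
    high : ∀ x → x < p * M → x / p < M
    high x x<pM = m<n*o⇒m/o<n (subst (x <_) (*-comm p M) x<pM)

  -- The sign (-1)^i of F_p, represented by (p - 1)^i.
  sgn : ℕ → ℕ
  sgn i = suc k ^ i

  -- (p-1)^2 ≡ 1, so sgn only depends on the parity of its argument.
  sgn-square : suc k * suc k ≈ 1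
  sgn-square = ≈-trans (≡⇒≈ (expand k)) (≈-trans (+-cong (≈-refl {1}) (multiple≈0 k)) ≈-refl)
    where
    expand : ∀ k → suc k * suc k ≡ 1 + k * (2 + k)
    expand = solve-∀

  signF≡sgn : ∀ j x → signF p j x ≡ (sgn j * x) % p
  signF≡sgn zero          x = cong (_% p) (sym (*-identityˡ x))
  signF≡sgn (suc zero)    x = residue-eq (+-cancelˡ x (begin
    x + (p ∸ x % p)     ≈⟨ x+[n∸x%n]≈0 x ⟩
    0                   ≈⟨ x+pred[n]*x≈0 x ⟨
    x + suc k * x       ≡⟨ cong (λ t → x + t * x) (*-identityʳ (suc k)) ⟨
    x + sgn 1 * x       ∎))
    where open ≈-Reasoning
  signF≡sgn (suc (suc j)) x = begin
    signF p (2 + j) x          ≡⟨ signF-parity p (2 + j) j x 2+j≡j ⟩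
    signF p j x                ≡⟨ signF≡sgn j x ⟩
    (sgn j * x) % p            ≡⟨ residue-eq period ⟨
    (sgn (2 + j) * x) % p      ∎
    where
    open ≡-Reasoning
    2+j≡j : (2 + j) % 2 ≡ j % 2
    2+j≡j = trans (cong (_% 2) (+-comm 2 j)) ([m+n]%n≡m%n j 2)
    period : sgn (2 + j) * x ≈ sgn j * x
    period = *-cong (≈-trans (≡⇒≈ (sym (*-assoc (suc k) (suc k) (sgn j))))
                             (≈-trans (*-cong sgn-square (≈-refl {sgn j})) (≡⇒≈ (*-identityˡ (sgn j)))))
                    (≈-refl {x})

  signF-cong : ∀ j j' x → (p % 2 ≡ 1 → j % 2 ≡ j' % 2) → signF p j x ≡ signF p j' x
  signF-cong j j' x parity with prime-two-or-odd k p-prime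
  ... | inj₂ p-odd = signF-parity p j j' x (parity p-odd)
  ... | inj₁ k≡0   = subst (λ k → signF (2 + k) j x ≡ signF (2 + k) j' x) (sym k≡0)
                           (trans (signF-two j x) (sym (signF-two j' x)))

  signF-unit : ∀ j → signF p j 1 ≢ 0
  signF-unit j with j % 2 ≡ᵇ 0
  ... | true  = λ ()
  ... | false = λ p-1≡0 → case (trans (sym (m<n⇒m%n≡m (n<1+n (suc k)))) p-1≡0) of λ ()

  signF-resp : ∀ j {x y} → x ≈ y → signF p j x ≡ signF p j y
  signF-resp j {x} {y} x≈y =
    trans (signF≡sgn j x) (trans (residue-eq (*-cong (≈-refl {sgn j}) x≈y)) (sym (signF≡sgn j y)))

  signF-zero : ∀ j → signF p j 0 ≡ 0
  signF-zero j = trans (signF≡sgn j 0) (cong (_% p) (*-zeroʳ (sgn j)))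

  -- If p - 1 divides j + i then (-1)^j = (-1)^i, as p - 1 is even for odd p.
  signF-[p-1]∣ : ∀ j i x → suc k ∣ j + i → signF p j x ≡ signF p i x
  signF-[p-1]∣ j i x p-1∣j+i = signF-cong j i x λ p-odd → Mod2.residue-eq
    (Mod2.+-cancelʳ i (Mod2.≈-trans (Mod2.∣⇒≈0 (∣-trans (2∣p-1 p-odd) p-1∣j+i))
                                    (Mod2.≈-sym (Mod2.≈-trans (Mod2.≡⇒≈ (i+i≡i*2 i)) (Mod2.multiple≈0 i)))))
    where
    module Mod2 = Congruence 2
    i+i≡i*2 : ∀ i → i + i ≡ i * 2
    i+i≡i*2 = solve-∀
    2∣p-1 : p % 2 ≡ 1 → 2 ∣ suc k
    2∣p-1 p-odd = Mod2.≈0⇒∣ (Mod2.+-cancelʳ 1 (Mod2.≈-trans (Mod2.≡⇒≈ (+-comm (suc k) 1)) (Mod2.mk≈ p-odd)))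

  -- C(p-1,i) ≡ (-1)^i, from C(p,i) ≡ 0 for 0 < i < p.
  binom[p-1,i] : ∀ i → i < p → binom (suc k) i ≈ sgn i
  binom[p-1,i] zero    _   = ≈-refl
  binom[p-1,i] (suc i) i<p = +-cancelʳ (binom (suc k) i) (begin
    binom (suc k) (suc i) + binom (suc k) i  ≡⟨ +-comm (binom (suc k) (suc i)) (binom (suc k) i) ⟩
    binom p (suc i)                          ≈⟨ ∣⇒≈0 (p∣binom[p,j] (suc i) z<s i<p) ⟩
    0                                        ≈⟨ x+pred[n]*x≈0 (sgn i) ⟨
    sgn i + sgn (suc i)                      ≡⟨ +-comm (sgn i) (sgn (suc i)) ⟩
    sgn (suc i) + sgn i                      ≈⟨ +-cong (≈-refl {sgn (suc i)}) (binom[p-1,i] i (<-trans (n<1+n i) i<p)) ⟨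
    sgn (suc i) + binom (suc k) i            ∎)
    where open ≈-Reasoning

  binom[p-2,i] : ∀ i → i ≤ k → binom k i ≈ sgn i * suc i
  binom[p-2,i] zero    _     = ≈-refl
  binom[p-2,i] (suc i) 1+i≤k = +-cancelʳ (binom k i) (begin
    binom k (suc i) + binom k i             ≡⟨ +-comm (binom k (suc i)) (binom k i) ⟩
    binom (suc k) (suc i)                   ≈⟨ binom[p-1,i] (suc i) (s≤s (m≤n⇒m≤1+n 1+i≤k)) ⟩
    sgn (suc i)                             ≡⟨ +-identityʳ (sgn (suc i)) ⟨
    sgn (suc i) + 0                         ≈⟨ +-cong (≈-refl {sgn (suc i)}) (multiple≈0 (sgn i * suc i)) ⟨
    sgn (suc i) + sgn i * suc i * p         ≡⟨ regroup k (sgn i) i ⟨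
    sgn (suc i) * suc (suc i) + sgn i * suc i
      ≈⟨ +-cong (≈-refl {sgn (suc i) * suc (suc i)}) (binom[p-2,i] i (<⇒≤ 1+i≤k)) ⟨
    sgn (suc i) * suc (suc i) + binom k i   ∎)
    where
    open ≈-Reasoning
    regroup : ∀ k s i → suc k * s * (2 + i) + s * (1 + i) ≡ suc k * s + s * (1 + i) * (2 + k)
    regroup = solve-∀

  invF-inverse : ∀ x → 0 < x → x < p → invF p x * x ≈ 1
  invF-inverse x@(suc _) _ x<p with coprime⇒invertible (prime⇒coprime p-prime x<p)
  ... | y , xy≈1 = ≈-trans (≡⇒≈ (*-comm (invF p x) x)) (mk≈ (≡ᵇ⇒≡ _ 1 (Equivalence.from T-≡ found)))
    where
    P : ℕ → Bool
    P z = (x * z) % p ≡ᵇ 1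
    y%p-works : P (y % p) ≡ true
    y%p-works = Equivalence.to T-≡ (≡⇒≡ᵇ _ 1 (residue-eq (≈-trans (*-cong (≈-refl {x}) (%-≈ y)) xy≈1)))
    found : P (least p P) ≡ true
    found = proj₂ (least-found p P (y % p) (m%n<n y p) y%p-works)

  inverse*binom[p-2,i] : ∀ i → i ≤ k → invF p (suc i) * binom k i ≈ sgn i
  inverse*binom[p-2,i] i i≤k = begin
    y * binom k i        ≈⟨ *-cong (≈-refl {y}) (binom[p-2,i] i i≤k) ⟩
    y * (sgn i * suc i)  ≡⟨ x∙yz≈y∙xz y (sgn i) (suc i) ⟩
    sgn i * (y * suc i)  ≈⟨ *-cong (≈-refl {sgn i}) (invF-inverse (suc i) z<s (s≤s (s≤s i≤k))) ⟩
    sgn i * 1            ≡⟨ *-identityʳ (sgn i) ⟩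
    sgn i                ∎
    where
    open ≈-Reasoning
    y : ℕ
    y = invF p (suc i)
    x∙yz≈y∙xz : ∀ x y z → x * (y * z) ≡ y * (x * z)
    x∙yz≈y∙xz = solve-∀

module MinimalExponent (k : ℕ) where

  private
    p : ℕ
    p = 2 + k

  -- p^n > n, so a ≤ p^a witnesses the search defining m(a).
  n<p^n : ∀ n → n < p ^ n
  n<p^n zero    = z<s
  n<p^n (suc n) = begin-strict
    suc n           <⟨ s≤s (n<p^n n) ⟩
    suc (p ^ n)     ≡⟨ +-comm 1 (p ^ n) ⟩
    p ^ n + 1       ≤⟨ +-monoʳ-≤ (p ^ n) (≤-trans (m^n>0 p n) (m≤m+n (p ^ n) (k * p ^ n))) ⟩
    p * p ^ n       ∎
    where open ≤-Reasoning

  private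
    bound : ℕ → ℕ → Bool
    bound a i = a ≤ᵇ p ^ i

    a≤p^a : ∀ a → bound a a ≡ true
    a≤p^a a = ≤⇒≤ᵇ≡true (<⇒≤ (n<p^n a))

  a≤p^m : ∀ a → a ≤ p ^ mOf p a
  a≤p^m a = ≤ᵇ≡true⇒≤ (proj₂ (least-found (suc a) (bound a) a (n<1+n a) (a≤p^a a)))

  m≤a : ∀ a → mOf p a ≤ a
  m≤a a = least-minimal (suc a) (bound a) a (a≤p^a a)

  m-minimal : ∀ a i → i < mOf p a → ¬ (a ≤ p ^ i)
  m-minimal a i i<m a≤p^i with trans (sym (≤⇒≤ᵇ≡true a≤p^i)) (least-before (suc a) (bound a) i i<m)
  ... | ()

  m-scale : ∀ e a → 1 ≤ a → mOf p (p ^ e * a) ≡ e + mOf p a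
  m-scale e a 1≤a = least-unique (suc (E * a)) (bound (E * a)) (e + m) (s≤s e+m≤Ea) bound-holds below-fails
    where
    instance _ = m^n≢0 p e
    E m : ℕ
    E = p ^ e
    m = mOf p a
    e+m≤Ea : e + m ≤ E * a
    e+m≤Ea = begin
      e + m        ≤⟨ +-monoʳ-≤ e (m≤a a) ⟩
      e + a        ≡⟨ +-comm e a ⟩
      a + e        ≤⟨ +-monoʳ-≤ a (m≤m*n e a {{>-nonZero 1≤a}}) ⟩
      suc e * a    ≤⟨ *-monoˡ-≤ a (n<p^n e) ⟩
      E * a        ∎
      where open ≤-Reasoning
    bound-holds : bound (E * a) (e + m) ≡ true
    bound-holds = ≤⇒≤ᵇ≡true (subst (E * a ≤_) (sym (^-distribˡ-+-* p e m)) (*-monoʳ-≤ E (a≤p^m a)))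
    below-fails : ∀ i → i < e + m → bound (E * a) i ≡ false
    below-fails i i<e+m with i <? e
    ... | yes i<e = ≰⇒≤ᵇ≡false λ Ea≤p^i →
          <-irrefl refl (<-≤-trans (^-monoʳ-< p (s≤s (s≤s z≤n)) i<e)
                                   (≤-trans (m≤m*n E a {{>-nonZero 1≤a}}) Ea≤p^i))
    ... | no  i≮e = ≰⇒≤ᵇ≡false λ Ea≤p^i →
          m-minimal a (i ∸ e) (+-cancelˡ-< e (i ∸ e) m (subst (_< e + m) i≡e+t i<e+m))
            (*-cancelˡ-≤ E (subst (E * a ≤_) (trans (cong (p ^_) i≡e+t) (^-distribˡ-+-* p e (i ∸ e))) Ea≤p^i))
      where
      i≡e+t : i ≡ e + (i ∸ e)
      i≡e+t = sym (m+[n∸m]≡n (≮⇒≥ i≮e))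

-- The data j ↦ (i_j, l_j, f_{a,j}, φ_a(l_j)) for a prime p = 2 + k and
-- q = 2 + D, where q - 1 is prime to p (true when q is a power of p).

module PrimePower (k D : ℕ) (p-prime : Prime (2 + k)) (d⊥p : Coprime (suc D) (2 + k)) where

  open ModPrime k p-prime
  open MinimalExponent k

  q d : ℕ
  q = 2 + D
  d = suc D

  solves : ℕ → ℕ → ℕ → Bool
  solves a j i = ⌊ d ∣? (j + i * p ^ mOf p a) ⌋

  -- i_j really solves j + i p^m ≡ 0 (mod q-1): p^m is a unit mod q-1.
  i-spec : ∀ a j → iOf p q a j < d × d ∣ j + iOf p q a j * p ^ mOf p a
  i-spec a j with Congruence.unit⇒solvable d (coprime-^ d⊥p (mOf p a)) j
  ... | i , i<d , d∣j+iM with least-found d (solves a j) i i<d (⌊⌋-true (d ∣? _) d∣j+iM)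
  ...   | found<d , found = found<d , ⌊⌋-sound (d ∣? _) found

  l-spec : ∀ a j → lOf p q a j * d ≡ j + iOf p q a j * p ^ mOf p a
  l-spec a j = m/n*n≡m (proj₂ (i-spec a j))

  l₀≡0 : ∀ a → lOf p q a 0 ≡ 0
  l₀≡0 a rewrite least-unique d (solves a 0) 0 z<s (⌊⌋-true (d ∣? 0) (d ∣0)) (λ _ ()) = refl

  -- l_j ≥ 1 for j ≥ 1, since q - 1 divides the positive number j + i_j p^m.
  l≥1 : ∀ a j → 1 ≤ j → 1 ≤ lOf p q a j
  l≥1 a j 1≤j = m≥n⇒m/n>0 (∣⇒≤ {{>-nonZero X>0}} (proj₂ (i-spec a j)))
    where
    X>0 : 0 < j + iOf p q a j * p ^ mOf p a
    X>0 = ≤-trans 1≤j (m≤m+n j _)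

  φ-decreasing : ∀ a l → 1 ≤ l → a < p ^ mOf p a → φ p q a l < φ p q a 0
  φ-decreasing a l 1≤l a<M = decrease (d * M ∸ a) (l * d) r-a>0 (≤-trans 1≤l (m≤m*n l d))
    where
    M : ℕ
    M = p ^ mOf p a
    r-a>0 : 0 < d * M ∸ a
    r-a>0 = m<n⇒0<n∸m (<-≤-trans a<M (m≤n*m M d))
    decrease : ∀ x y → 0 < x → 0 < y → x ∸ y < x
    decrease (suc x) (suc y) _ _ = s≤s (m∸n≤m x y)

  T-top : ∀ a → T p q a (1 , φ p q a 0)
  T-top a = 0 , z≤n , (λ ()) , cong (λ l → 1 , φ p q a l) (sym (l₀≡0 a))

  -- (b), ⇒: if a < p^m then j = p^m - a gives f = ±1 ≠ 0 and a smaller φ.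
  T-singleton⇒a≡p^m : ∀ a → SetEq (T p q a) (λ x → x ≡ (1 , φ p q a 0)) → a ≡ p ^ mOf p a
  T-singleton⇒a≡p^m a T≡top with m≤n⇒m<n∨m≡n (a≤p^m a)
  ... | inj₂ a≡M = a≡M
  ... | inj₁ a<M = ⊥-elim (<-irrefl φ-equal (φ-decreasing a (lOf p q a N) (l≥1 a N N≥1) a<M))
    where
    N : ℕ
    N = p ^ mOf p a ∸ a
    N≥1 : 1 ≤ N
    N≥1 = m<n⇒0<n∸m a<M
    f≢0 : fOf p a N ≢ 0
    f≢0 = subst (λ c → signF p N c ≢ 0) (sym (nCn≡1 N)) (signF-unit N)
    φ-equal : φ p q a (lOf p q a N) ≡ φ p q a 0
    φ-equal = cong proj₂ (proj₁ (T≡top _) (N , ≤-refl , f≢0 , refl))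

  -- (b), ⇐: if a = p^m only j = 0 is available.
  a≡p^m⇒T-singleton : ∀ a → a ≡ p ^ mOf p a → SetEq (T p q a) (λ x → x ≡ (1 , φ p q a 0))
  a≡p^m⇒T-singleton a a≡M x = only-top , λ { refl → T-top a }
    where
    N≡0 : p ^ mOf p a ∸ a ≡ 0
    N≡0 = trans (cong (p ^ mOf p a ∸_) a≡M) (n∸n≡0 (p ^ mOf p a))
    only-top : T p q a x → x ≡ (1 , φ p q a 0)
    only-top (j , j≤N , _ , refl) with n≤0⇒n≡0 (subst (j ≤_) N≡0 j≤N)
    ... | refl = cong (λ l → 1 , φ p q a l) (l₀≡0 a)

  module Scaling (e a : ℕ) (1≤a : 1 ≤ a) where

    instance _ = m^n≢0 p e

    E M N a' M' : ℕ
    E  = p ^ e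
    M  = p ^ mOf p a
    N  = M ∸ a
    a' = E * a
    M' = p ^ mOf p a'

    M'≡EM : M' ≡ E * M
    M'≡EM = trans (cong (p ^_) (m-scale e a 1≤a)) (^-distribˡ-+-* p e (mOf p a))

    N'≡NE : M' ∸ a' ≡ N * E
    N'≡NE = trans (cong (_∸ a') M'≡EM) (trans (sym (*-distribˡ-∸ E M a)) (*-comm E N))

    f'≡ : ∀ j → fOf p a' j ≡ signF p j (binom (N * E + 0) j)
    f'≡ j = cong (signF p j) (trans (cong (_C j) (trans N'≡NE (sym (+-identityʳ _)))) (sym (binom≡C _ j)))

    -- By Lucas, C(N E, j) ≡ 0 (mod p) unless E ∣ j ...
    E∣j : ∀ j → fOf p a' j ≢ 0 → E ∣ j
    E∣j j f≢0 with j % E ≟ 0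
    ... | yes j%E≡0 = m%n≡0⇒n∣m j E j%E≡0
    ... | no  j%E≢0 = ⊥-elim (f≢0 (begin
      fOf p a' j                                    ≡⟨ f'≡ j ⟩
      signF p j (binom (N * E + 0) j)               ≡⟨ cong (λ t → signF p j (binom (N * E + 0) t)) digits ⟩
      signF p j (binom (N * E + 0) (j / E * E + j % E))
        ≡⟨ signF-resp j (lucas e N 0 (j / E) (j % E) (m^n>0 p e) (m%n<n j E)) ⟩
      signF p j (binom N (j / E) * binom 0 (j % E)) ≡⟨ cong (λ t → signF p j (binom N (j / E) * t)) C[0,j%E]≡0 ⟩
      signF p j (binom N (j / E) * 0)               ≡⟨ cong (signF p j) (*-zeroʳ (binom N (j / E))) ⟩
      signF p j 0                                   ≡⟨ signF-zero j ⟩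
      0                                             ∎))
      where
      open ≡-Reasoning
      digits : j ≡ j / E * E + j % E
      digits = trans (m≡m%n+[m/n]*n j E) (+-comm (j % E) (j / E * E))
      C[0,j%E]≡0 : binom 0 (j % E) ≡ 0
      C[0,j%E]≡0 = binom-vanish 0 (j % E) (n≢0⇒n>0 j%E≢0)

    -- ... and C(N E, t E) ≡ C(N, t), while (-1)^{tE} = (-1)^t.
    f'-scaled : ∀ t → fOf p a' (t * E) ≡ fOf p a t
    f'-scaled t = begin
      fOf p a' (t * E)                         ≡⟨ f'≡ (t * E) ⟩
      signF p (t * E) (binom (N * E + 0) (t * E))
        ≡⟨ cong (λ u → signF p (t * E) (binom (N * E + 0) u)) (+-identityʳ (t * E)) ⟨
      signF p (t * E) (binom (N * E + 0) (t * E + 0)) ≡⟨ signF-resp (t * E) (lucas e N 0 t 0 (m^n>0 p e) (m^n>0 p e)) ⟩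
      signF p (t * E) (binom N t * 1)          ≡⟨ cong (signF p (t * E)) (*-identityʳ (binom N t)) ⟩
      signF p (t * E) (binom N t)              ≡⟨ signF-cong (t * E) t (binom N t) tE≡t[mod2] ⟩
      signF p t (binom N t)                    ≡⟨ cong (signF p t) (binom≡C N t) ⟩
      fOf p a t                                ∎
      where
      open ≡-Reasoning
      module Mod2 = Congruence 2
      tE≡t[mod2] : p % 2 ≡ 1 → (t * E) % 2 ≡ t % 2
      tE≡t[mod2] p-odd = Mod2.residue-eq (Mod2.≈-trans
        (Mod2.*-cong (Mod2.≈-refl {t}) (Mod2.≈-trans (Mod2.^-cong e (Mod2.mk≈ p-odd)) (Mod2.≡⇒≈ (^-zeroˡ e))))
        (Mod2.≡⇒≈ (*-identityʳ t)))

    rescale : ∀ t i → t * E + i * M' ≡ E * (t + i * M)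
    rescale t i = trans (cong (λ u → t * E + i * u) M'≡EM) (shape t i E M)
      where
      shape : ∀ t i E M → t * E + i * (E * M) ≡ E * (t + i * M)
      shape = solve-∀

    -- i_{tE} for a' equals i_t for a, since E is a unit mod q - 1.
    i'-scaled : ∀ t → iOf p q a' (t * E) ≡ iOf p q a t
    i'-scaled t = least-cong d (solves a' (t * E)) (solves a t) λ i →
      ⌊⌋-⇔ (mk⇔ (λ d∣ → coprime-divisor (coprime-^ d⊥p e) (subst (d ∣_) (rescale t i) d∣))
                 (λ d∣ → subst (d ∣_) (sym (rescale t i)) (∣n⇒∣m*n E d∣)))
           (d ∣? _) (d ∣? _)

    l'-scaled : ∀ t → lOf p q a' (t * E) ≡ E * lOf p q a t
    l'-scaled t = begin
      (t * E + iOf p q a' (t * E) * M') / d  ≡⟨ cong (λ i → (t * E + i * M') / d) (i'-scaled t) ⟩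
      (t * E + i * M') / d                   ≡⟨ cong (_/ d) (rescale t i) ⟩
      E * (t + i * M) / d                    ≡⟨ *-/-assoc E (proj₂ (i-spec a t)) ⟩
      E * lOf p q a t                        ∎
      where
      open ≡-Reasoning
      i : ℕ
      i = iOf p q a t

    -- φ_{a'}(E l) = E φ_a(l), because r_{a'} - a' = E (r_a - a).
    φ'-scaled : ∀ l → φ p q a' (E * l) ≡ E * φ p q a l
    φ'-scaled l = begin
      d * M' ∸ E * a ∸ E * l * d
        ≡⟨ cong₂ (λ u v → u ∸ E * a ∸ v) (trans (cong (d *_) M'≡EM) (x∙yz≈y∙xz d E M)) (*-assoc E l d) ⟩
      E * (d * M) ∸ E * a ∸ E * (l * d)   ≡⟨ cong (_∸ E * (l * d)) (*-distribˡ-∸ E (d * M) a) ⟨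
      E * (d * M ∸ a) ∸ E * (l * d)       ≡⟨ *-distribˡ-∸ E (d * M ∸ a) (l * d) ⟨
      E * (d * M ∸ a ∸ l * d)             ∎
      where
      open ≡-Reasoning
      x∙yz≈y∙xz : ∀ x y z → x * (y * z) ≡ y * (x * z)
      x∙yz≈y∙xz = solve-∀

    entry-scaled : ∀ t → (fOf p a' (t * E) , φ p q a' (lOf p q a' (t * E)))
                         ≡ (fOf p a t , E * φ p q a (lOf p q a t))
    entry-scaled t = cong₂ _,_ (f'-scaled t) (trans (cong (φ p q a') (l'-scaled t)) (φ'-scaled (lOf p q a t)))

    T-scaled : SetEq (T p q a') (Tscaled p q a e)
    T-scaled x = to , from
      where
      to : T p q a' x → Tscaled p q a e x
      to (j , j≤N' , f≢0 , refl) with E∣j j f≢0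
      ... | divides t refl = t , *-cancelʳ-≤ t N E (subst (t * E ≤_) N'≡NE j≤N') ,
            (λ f≡0 → f≢0 (trans (f'-scaled t) f≡0)) , entry-scaled t
      from : Tscaled p q a e x → T p q a' x
      from (t , t≤N , f≢0 , refl) = t * E , subst (t * E ≤_) (sym N'≡NE) (*-monoˡ-≤ E t≤N) ,
            (λ f≡0 → f≢0 (trans (sym (f'-scaled t)) f≡0)) , sym (entry-scaled t)


consecutive-coprime : ∀ n → Coprime n (suc n)
consecutive-coprime n {i} (i∣n , i∣1+n) = ∣1⇒≡1 (∣m+n∣m⇒∣n (subst (i ∣_) (+-comm 1 n) i∣1+n) i∣n)

div-add : ∀ x y d .{{_ : NonZero d}} → (x + y * d) / d ≡ x / d + y
div-add x y d = trans (+-distrib-/-∣ʳ x (n∣m*n y)) (cong (x / d +_) (m*n/n≡m y d))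

ceilDiv-char : ∀ X J i → i * J < X → X ≤ suc i * J → ceilDiv X J ≡ suc i
ceilDiv-char X zero i iJ<X X≤0 =
  ⊥-elim (<⇒≱ (≤-<-trans z≤n iJ<X) (≤-trans X≤0 (≤-reflexive (*-zeroʳ (suc i)))))
ceilDiv-char X (suc e) i iJ<X X≤[i+1]J = begin-equality
  (X + e) / J                 ≡⟨ cong (_/ J) (m∸n+n≡m [i+1]J≤X+e) ⟨
  (ρ + suc i * J) / J         ≡⟨ div-add ρ (suc i) J ⟩
  ρ / J + suc i               ≡⟨ cong (_+ suc i) (m<n⇒m/n≡0 ρ<J) ⟩
  suc i                       ∎
  where
  open ≤-Reasoning
  J : ℕ
  J = suc e
  expand : ∀ i e → suc i * suc e ≡ suc (i * suc e) + e
  expand = solve-∀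
  [i+1]J≤X+e : suc i * J ≤ X + e
  [i+1]J≤X+e = begin
    suc i * J              ≡⟨ expand i e ⟩
    suc (i * J) + e        ≤⟨ +-monoˡ-≤ e iJ<X ⟩
    X + e                  ∎
  ρ : ℕ
  ρ = X + e ∸ suc i * J
  ρ<J : ρ < J
  ρ<J = +-cancelʳ-< (suc i * J) ρ J (begin-strict
    ρ + suc i * J          ≡⟨ m∸n+n≡m [i+1]J≤X+e ⟩
    X + e                  ≤⟨ +-monoˡ-≤ e X≤[i+1]J ⟩
    suc i * J + e          <⟨ +-monoʳ-< (suc i * J) (n<1+n e) ⟩
    suc i * J + J          ≡⟨ +-comm (suc i * J) J ⟩
    J + suc i * J          ∎)

ceiling-bounds : ∀ i r w t U → 1 ≤ w → w ≤ t → t ≤ U →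
  i * (t + (i + r) * U) < (w + i * U) * suc (i + r) ×
  (w + i * U) * suc (i + r) ≤ suc i * (t + (i + r) * U)
ceiling-bounds i r w@(suc w') t U _ w≤t t≤U = lower , upper
  where
  γ α β : ℕ
  γ = U ∸ t
  α = t ∸ w
  β = U ∸ w
  lower-gap : ∀ i r w' t γ → suc (i * (t + (i + r) * (t + γ)) + ((i + r) + w' * suc (i + r) + i * γ))
                              ≡ (suc w' + i * (t + γ)) * suc (i + r)
  lower-gap = solve-∀
  lower : i * (t + (i + r) * U) < (w + i * U) * suc (i + r)
  lower = subst (λ V → i * (t + (i + r) * V) < (w + i * V) * suc (i + r)) (m+[n∸m]≡n t≤U)
            (subst (i * (t + (i + r) * (t + γ)) <_) (lower-gap i r w' t γ) (s≤s (m≤m+n _ _)))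
  upper-gap : ∀ i r w α β → suc i * ((w + α) + (i + r) * (w + β))
                            ≡ (w + i * (w + β)) * suc (i + r) + (r * β + suc i * α)
  upper-gap = solve-∀
  upper : (w + i * U) * suc (i + r) ≤ suc i * (t + (i + r) * U)
  upper = subst₂ (λ T V → (w + i * V) * suc (i + r) ≤ suc i * (T + (i + r) * V))
            (m+[n∸m]≡n w≤t) (m+[n∸m]≡n (≤-trans w≤t t≤U))
            (subst ((w + i * (w + β)) * suc (i + r) ≤_) (sym (upper-gap i r w α β)) (m≤m+n _ _))

repunit : ℕ → ℕ → ℕ
repunit p zero    = 0
repunit p (suc m) = 1 + p * repunit p m

p^m≡1+[p-1]repunit : ∀ k m → (2 + k) ^ m ≡ 1 + suc k * repunit (2 + k) m
p^m≡1+[p-1]repunit k zero    = cong suc (sym (*-zeroʳ (suc k)))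
p^m≡1+[p-1]repunit k (suc m) =
  trans (cong ((2 + k) *_) (p^m≡1+[p-1]repunit k m)) (shape k (repunit (2 + k) m))
  where
  shape : ∀ k u → (2 + k) * (1 + suc k * u) ≡ 1 + suc k * (1 + (2 + k) * u)
  shape = solve-∀

module PrimeField (k : ℕ) (p-prime : Prime (2 + k)) where

  open ModPrime k p-prime
  open MinimalExponent k
  open PrimePower k k p-prime (consecutive-coprime (suc k))

  module _ (a : ℕ) (1≤a : 1 ≤ a) where

    M N U R J t : ℕ
    M = p ^ mOf p a
    N = M ∸ a
    U = repunit p (mOf p a)
    R = d * M ∸ a
    J = jmax p q a
    t = (N + k) / d

    -- Writing p^m = 1 + (p-1)U makes r_a - a and j_{a,max} explicit.
    M≡1+dU : M ≡ 1 + d * U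
    M≡1+dU = p^m≡1+[p-1]repunit k (mOf p a)

    N<M : N < M
    N<M = ∸-monoʳ-< 1≤a (a≤p^m a)

    R≡kM+N : R ≡ k * M + N
    R≡kM+N = trans (cong (_∸ a) (+-comm M (k * M))) (+-∸-assoc (k * M) (a≤p^m a))

    J≡t+kU : J ≡ t + k * U
    J≡t+kU = trans (cong (_/ d) (trans R≡kM+N (trans (cong (λ v → k * v + N) M≡1+dU) (shape k U N))))
                   (div-add (N + k) (k * U) d)
      where
      shape : ∀ k U N → k * (1 + suc k * U) + N ≡ (N + k) + k * U * suc k
      shape = solve-∀

    t≤U : t ≤ U
    t≤U = begin
      (N + k) / d        ≤⟨ /-monoˡ-≤ d (subst (N + k ≤_) (+-comm (U * d) k) (+-monoˡ-≤ k N≤Ud)) ⟩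
      (k + U * d) / d    ≡⟨ div-add k U d ⟩
      k / d + U          ≡⟨ cong (_+ U) (m<n⇒m/n≡0 (n<1+n k)) ⟩
      U                  ∎
      where
      open ≤-Reasoning
      N≤Ud : N ≤ U * d
      N≤Ud = s≤s⁻¹ (subst (N <_) (trans M≡1+dU (cong suc (*-comm d U))) N<M)

    c-formula : ∀ l → 1 ≤ l → cOf p q a l ≡ (invF p (ceilDiv (l * d) J) * (R C (l * d))) % p
    c-formula (suc _) _ = refl

    module Column (j : ℕ) (j≤N : j ≤ N) (1≤j : 1 ≤ j) where

      i l w : ℕ
      i = iOf p q a j
      l = lOf p q a j
      w = (j + i) / d

      i≤k : i ≤ k
      i≤k = s≤s⁻¹ (proj₁ (i-spec a j))

      -- Since p^m ≡ 1 (mod p-1), the condition on i_j reads (p-1) ∣ j + i.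
      split : j + i * M ≡ i * U * d + (j + i)
      split = trans (cong (λ v → j + i * v) M≡1+dU) (shape j i U k)
        where
        shape : ∀ j i U k → j + i * (1 + suc k * U) ≡ i * U * suc k + (j + i)
        shape = solve-∀

      d∣j+i : d ∣ j + i
      d∣j+i = ∣m+n∣m⇒∣n (subst (d ∣_) split (proj₂ (i-spec a j))) (n∣m*n (i * U))

      l≡w+iU : l ≡ w + i * U
      l≡w+iU = *-cancelʳ-≡ l (w + i * U) d (begin
        l * d                ≡⟨ l-spec a j ⟩
        j + i * M            ≡⟨ split ⟩
        i * U * d + (j + i)  ≡⟨ cong (i * U * d +_) (m/n*n≡m d∣j+i) ⟨
        i * U * d + w * d    ≡⟨ +-comm (i * U * d) (w * d) ⟩
        w * d + i * U * d    ≡⟨ *-distribʳ-+ d w (i * U) ⟨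
        (w + i * U) * d      ∎)
        where open ≡-Reasoning

      1≤w : 1 ≤ w
      1≤w = m≥n⇒m/n>0 (∣⇒≤ {{>-nonZero (≤-trans 1≤j (m≤m+n j i))}} d∣j+i)

      w≤t : w ≤ t
      w≤t = /-monoˡ-≤ d (+-mono-≤ j≤N i≤k)

      ceil : ceilDiv (l * d) J ≡ suc i
      ceil = ceilDiv-char (l * d) J i
        (subst₂ _<_ (cong (i *_) (sym J≡t+kU)) (sym ld≡) (proj₁ bounds))
        (subst₂ _≤_ (sym ld≡) (cong (suc i *_) (sym J≡t+kU)) (proj₂ bounds))
        where
        ld≡ : l * d ≡ (w + i * U) * d
        ld≡ = cong (_* d) l≡w+iU
        bounds : i * (t + k * U) < (w + i * U) * d × (w + i * U) * d ≤ suc i * (t + k * U)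
        bounds = subst (λ K → i * (t + K * U) < (w + i * U) * suc K × (w + i * U) * suc K ≤ suc i * (t + K * U))
                       (m+[n∸m]≡n i≤k) (ceiling-bounds i (k ∸ i) w t U 1≤w w≤t t≤U)

      binom-R : R C (l * d) ≈ binom k i * binom N j
      binom-R = ≈-trans (≡⇒≈ (trans (sym (binom≡C R (l * d)))
                                    (cong₂ binom R≡kM+N (trans (l-spec a j) (+-comm j (i * M))))))
                        (lucas (mOf p a) k N i j N<M (≤-<-trans j≤N N<M))

      c≡f : cOf p q a l ≡ fOf p a j
      c≡f = begin
        cOf p q a l                                          ≡⟨ c-formula l (l≥1 a j 1≤j) ⟩
        (invF p (ceilDiv (l * d) J) * (R C (l * d))) % p    ≡⟨ cong (λ c → (invF p c * (R C (l * d))) % p) ceil ⟩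
        (invF p (suc i) * (R C (l * d))) % p                 ≡⟨ residue-eq c≈ ⟩
        (sgn i * binom N j) % p                              ≡⟨ signF≡sgn i (binom N j) ⟨
        signF p i (binom N j)                                ≡⟨ signF-[p-1]∣ j i (binom N j) d∣j+i ⟨
        signF p j (binom N j)                                ≡⟨ cong (signF p j) (binom≡C N j) ⟩
        fOf p a j                                            ∎
        where
        open ≡-Reasoning
        y : ℕ
        y = invF p (suc i)
        c≈ : y * (R C (l * d)) ≈ sgn i * binom N j
        c≈ = ≈-trans (*-cong (≈-refl {y}) binom-R)
               (≈-trans (≡⇒≈ (sym (*-assoc y (binom k i) (binom N j))))
                        (*-cong (inverse*binom[p-2,i] i i≤k) (≈-refl {binom N j})))

    c≡f : ∀ j → j ≤ N → cOf p q a (lOf p q a j) ≡ fOf p a j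
    c≡f zero    _   rewrite l₀≡0 a = refl
    c≡f (suc j) j≤N = Column.c≡f (suc j) j≤N (s≤s z≤n)

    T≡Tc : SetEq (T p q a) (Tc p q a)
    T≡Tc x = to , from
      where
      to : T p q a x → Tc p q a x
      to (j , j≤N , f≢0 , refl) = j , j≤N , f≢0 , cong (_, φ p q a (lOf p q a j)) (sym (c≡f j j≤N))
      from : Tc p q a x → T p q a x
      from (j , j≤N , f≢0 , refl) = j , j≤N , f≢0 , cong (_, φ p q a (lOf p q a j)) (c≡f j j≤N)

prime-form : ∀ {p} → Prime p → ∃[ k ] p ≡ 2 + k
prime-form {p} p-prime = p ∸ 2 , sym (m+[n∸m]≡n (nonTrivial⇒n>1 p {{prime⇒nonTrivial p-prime}}))

2≤p^[1+s] : ∀ k s → 2 ≤ (2 + k) ^ suc s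
2≤p^[1+s] k s = ≤-trans (s≤s (s≤s z≤n)) (m≤m*n (2 + k) ((2 + k) ^ s) {{m^n≢0 (2 + k) s}})

prime-power-form : ∀ k s → 1 ≤ s → ∃[ D ] (2 + k) ^ s ≡ 2 + D
prime-power-form k (suc s) _ = (2 + k) ^ suc s ∸ 2 , sym (m+[n∸m]≡n (2≤p^[1+s] k s))

-- q - 1 is prime to p, since q - 1 and q are consecutive.
power-pred-coprime : ∀ k s D → 1 ≤ s → (2 + k) ^ s ≡ 2 + D → Coprime (suc D) (2 + k)
power-pred-coprime k (suc s) D _ p^s≡q {i} (i∣q-1 , i∣p) =
  consecutive-coprime (suc D) (i∣q-1 , subst (i ∣_) p^s≡q (∣-trans i∣p (m∣m*n ((2 + k) ^ s))))

prime-power-prime : ∀ k s D → 1 ≤ s → (2 + k) ^ s ≡ 2 + D → Prime (2 + D) → D ≡ k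
prime-power-prime k (suc zero) D _ p^s≡q _ = sym (suc-injective (suc-injective (trans (sym (*-identityʳ (2 + k))) p^s≡q)))
prime-power-prime k (suc (suc s)) D _ p^s≡q q-prime =
  ⊥-elim (prime⇒¬composite q-prime (composite p<q p∣q))
  where
  p∣q : 2 + k ∣ 2 + D
  p∣q = divides ((2 + k) ^ suc s) (trans (sym p^s≡q) (*-comm (2 + k) ((2 + k) ^ suc s)))
  p<q : 2 + k < 2 + D
  p<q = subst (2 + k <_) p^s≡q (begin-strict
    2 + k                     ≡⟨ *-identityʳ (2 + k) ⟨
    (2 + k) * 1               <⟨ *-monoʳ-< (2 + k) (2≤p^[1+s] k s) ⟩
    (2 + k) * (2 + k) ^ suc s ∎)
    where open ≤-Reasoning

Corollary : ℕ → ℕ → ℕ → Set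
Corollary p q a =
    T p q a (1 , φ p q a 0)
    × ((SetEq (T p q a) (λ x → x ≡ (1 , φ p q a 0)) → a ≡ p ^ mOf p a)
    × (a ≡ p ^ mOf p a → SetEq (T p q a) (λ x → x ≡ (1 , φ p q a 0))))
    × ((m' : ℕ) → 1 ≤ m' → SetEq (T p q (p ^ m' * a)) (Tscaled p q a m'))
    × (Prime q → SetEq (T p q a) (Tc p q a))

corollary : ∀ k D a → Prime (2 + k) → Coprime (suc D) (2 + k) → (Prime (2 + D) → D ≡ k) → 1 ≤ a →
            Corollary (2 + k) (2 + D) a
corollary k D a p-prime d⊥p q-prime⇒q≡p 1≤a =
  T-top a , (T-singleton⇒a≡p^m a , a≡p^m⇒T-singleton a) , (λ e _ → Scaling.T-scaled e a 1≤a) , part-d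
  where
  open PrimePower k D p-prime d⊥p
  part-d : Prime (2 + D) → SetEq (T (2 + k) (2 + D) a) (Tc (2 + k) (2 + D) a)
  part-d q-prime with q-prime⇒q≡p q-prime
  ... | refl = PrimeField.T≡Tc k p-prime a 1≤a

corollary5p17 : (p s a : ℕ) → Prime p → 1 ≤ s → 1 ≤ a →
    T p (p ^ s) a (1 , φ p (p ^ s) a 0)
    × ((SetEq (T p (p ^ s) a) (λ x → x ≡ (1 , φ p (p ^ s) a 0)) → a ≡ p ^ mOf p a)
       × (a ≡ p ^ mOf p a → SetEq (T p (p ^ s) a) (λ x → x ≡ (1 , φ p (p ^ s) a 0))))
    × ((m' : ℕ) → 1 ≤ m' → SetEq (T p (p ^ s) (p ^ m' * a)) (Tscaled p (p ^ s) a m'))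
    × (Prime (p ^ s) → SetEq (T p (p ^ s) a) (Tc p (p ^ s) a))
corollary5p17 p s a p-prime 1≤s 1≤a with prime-form p-prime
... | k , refl with prime-power-form k s 1≤s
...   | D , p^s≡q rewrite p^s≡q =
  corollary k D a p-prime (power-pred-coprime k s D 1≤s p^s≡q) (prime-power-prime k s D 1≤s p^s≡q) 1≤a
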